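{- Let $q$ be a prime power. For every complete flag $F_\bullet\in\mathcal{F}_n$, $x^{(q)}(F_\bullet)=F_\bullet\cdot\mathcal{T}^*_n(q)$, where $\mathcal{T}^*_n(q)=\sum_{j=1}^{n}T_{s_{j-1}}T_{s_{j-2}}\cdots T_{s_1}$.
   Context: Let $\mathbb{F}_q$ be the field with $q$ elements and $\mathcal{F}_n$ the set of complete flags $F_\bullet=(F_1\subset F_2\subset\dots\subset F_n=\mathbb{F}_q^n)$, $\dim F_i=i$. $\mathcal{H}_n(q)$ is the Type A Iwahori–Hecke algebra with generators $T_{s_1},\dots,T_{s_{n-1}}$ and relations $T_{s_i}^2=(q-1)T_{s_i}+q$, $T_{s_i}T_{s_j}=T_{s_j}T_{s_i}$ ($|i-j|\ge2$), $T_{s_i}T_{s_{i+1}}T_{s_i}=T_{s_{i+1}}T_{s_i}T_{s_{i+1}}$. It acts on $\mathbb{C}[\mathcal{F}_n]$ from the right by $F_\bullet\cdot T_{s_i}=\sum_{G}(F_1\subset\dots\subset F_{i-1}\subset G\subset F_{i+1}\subset\dots\subset F_n)$, the sum over all $i$-dimensional subspaces $G\neq F_i$ with $F_{i-1}\subset G\subset F_{i+1}$ (with $F_0=0$). The $\mathbb{C}$-linear map $x^{(q)}$ on $\mathbb{C}[\mathcal{F}_n]$ is defined by $x^{(q)}(F_\bullet)=\sum_{i=1}^{n}\sum_{L_i}(L_i\subset L_i+F_1\subset\dots\subset L_i+F_{i-2}\subset F_i\subset F_{i+1}\subset\dots\subset F_n)$, the inner sum over lines $L_i$ with $L_i\subseteq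 F_i$, $L_i\not\subseteq F_{i-1}$. In $\mathcal{T}^*_n(q)$ the $j=1$ summand is $1$. -}

module Defs where

open import Data.Nat as ℕ using (ℕ; zero; suc; _^_; _<ᵇ_; _≡ᵇ_; _∸_)
open import Data.Nat.Primality using (Prime)
open import Data.Fin as Fin using (Fin; toℕ)
open import Data.Bool using (Bool; true; false; _∧_; _∨_; not; if_then_else_)
open import Data.List as List using (List; []; _∷_; [_]; concatMap; upTo; filterᵇ; length)
open import Data.Bool.ListAction using (all; any)
open import Data.Vec as Vec using (Vec; []; _∷_; lookup; tabulate; zipWith; replicate)
import Data.Vec.Properties as VecP
open import Data.Product using (Σ; ∃; _×_; _,_)
open import Relation.Nullary.Decidable using (⌊_⌋)
open import Relation.Binary.PropositionalEquality using (_≡_; _≢_)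
open import Algebra.Structures using (IsCommutativeRing)

IsPrimePower : ℕ → Set
IsPrimePower q = Σ ℕ λ p → Σ ℕ λ k → Prime p × q ≡ p ^ suc k

-- A field structure on the q-element set Fin q (every finite field with
-- q elements is isomorphic to one of these).
record FieldOn (q : ℕ) : Set where
  field
    _+_ _*_ : Fin q → Fin q → Fin q
    -_      : Fin q → Fin q
    0# 1#   : Fin q
    isCommutativeRing : IsCommutativeRing _≡_ _+_ _*_ -_ 0# 1#
    0≢1     : 0# ≢ 1#
    inverse : ∀ x → x ≢ 0# → ∃ λ y → x * y ≡ 1#

vecsOver : ∀ {A : Set} → List A → (m : ℕ) → List (Vec A m)
vecsOver xs zero    = [ [] ]
vecsOver xs (suc m) = concatMap (λ a → List.map (a ∷_) (vecsOver xs m)) xs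

module FlagTheory {q : ℕ} (K : FieldOn q) (n : ℕ) where
  open FieldOn K

  elems : List (Fin q)
  elems = List.allFin q

  V : Set
  V = Vec (Fin q) n

  allV : List V
  allV = vecsOver elems n

  _≟V_ : ∀ {m} → Vec (Fin q) m → Vec (Fin q) m → Bool
  u ≟V v = ⌊ VecP.≡-dec Fin._≟_ u v ⌋

  0V : V
  0V = replicate n 0#

  _+V_ : V → V → V
  _+V_ = zipWith _+_

  _-V_ : V → V → V
  u -V v = zipWith (λ a b → a + (- b)) u v

  _·V_ : Fin q → V → V
  c ·V v = Vec.map (c *_) v

  Sub : Set
  Sub = V → Bool

  _⊆ᵇ_ : Sub → Sub → Bool
  S ⊆ᵇ T = all (λ v → not (S v) ∨ T v) allV

  _≐_ : Sub → Sub → Bool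
  S ≐ T = (S ⊆ᵇ T) ∧ (T ⊆ᵇ S)

  zeroSub : Sub
  zeroSub v = v ≟V 0V

  fullSub : Sub
  fullSub _ = true

  _⊕_ : Sub → Sub → Sub
  (S ⊕ T) v = any (λ a → S a ∧ T (v -V a)) allV

  lin : ∀ {d} → Vec (Fin q) d → Vec V d → V
  lin []       []       = 0V
  lin (c ∷ cs) (b ∷ bs) = (c ·V b) +V lin cs bs

  span : ∀ {d} → Vec V d → Sub
  span {d} bs v = any (λ c → lin c bs ≟V v) (vecsOver elems d)

  indep : ∀ {d} → Vec V d → Bool
  indep {d} bs = all (λ c → not (lin c bs ≟V 0V) ∨ (c ≟V replicate d 0#))
                     (vecsOver elems d)

  HasDim : Sub → ℕ → Set
  HasDim S d = Σ (Vec V d) λ bs → indep bs ≡ true × (span bs ≐ S) ≡ true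

  dedup : List Sub → List Sub
  dedup []       = []
  dedup (S ∷ Ss) = S ∷ filterᵇ (λ T → not (S ≐ T)) (dedup Ss)

  Gr : ℕ → List Sub
  Gr d = dedup (List.map span (filterᵇ indep (vecsOver allV d)))

  -- a (raw) sequence of n subsets; pos F i is F_i (1-based),
  -- with F_0 = 0
  RawFlag : Set
  RawFlag = Vec Sub n

  pos : ∀ {m} → Vec Sub m → ℕ → Sub
  pos F        zero          = zeroSub
  pos []       (suc _)       = fullSub
  pos (S ∷ F)  (suc zero)    = S
  pos (S ∷ F)  (suc (suc k)) = pos F (suc k)

  IsFlag : RawFlag → Set
  IsFlag F = ∀ (k : Fin n) →
    HasDim (lookup F k) (suc (toℕ k)) × (pos F (toℕ k) ⊆ᵇ lookup F k) ≡ true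

  flagEq : RawFlag → RawFlag → Bool
  flagEq F G = all (λ k → lookup F k ≐ lookup G k) (List.allFin n)

  -- elements of ℕ[𝓕_n] ⊆ ℂ[𝓕_n] as finite formal sums (lists) of flags
  FSum : Set
  FSum = List RawFlag

  coeff : RawFlag → FSum → ℕ
  coeff H xs = length (filterᵇ (flagEq H) xs)

  _≈_ : FSum → FSum → Set
  xs ≈ ys = ∀ (H : RawFlag) → coeff H xs ≡ coeff H ys

  replaceAt : RawFlag → ℕ → Sub → RawFlag
  replaceAt F i G = tabulate λ k → if suc (toℕ k) ≡ᵇ i then G else lookup F k

  actT : ℕ → RawFlag → FSum
  actT i F = List.map (replaceAt F i)
    (filterᵇ (λ G → (pos F (i ∸ 1) ⊆ᵇ G) ∧ (G ⊆ᵇ pos F (suc i)) ∧ not (G ≐ pos F i))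
             (Gr i))

  _·T_ : FSum → ℕ → FSum
  xs ·T i = concatMap (actT i) xs

  applyDown : ℕ → FSum → FSum
  applyDown zero    xs = xs
  applyDown (suc m) xs = applyDown m (xs ·T suc m)

  FTstar : RawFlag → FSum
  FTstar F = concatMap (λ m → applyDown m [ F ]) (upTo n)

  -- the flag (L ⊂ L+F_1 ⊂ ⋯ ⊂ L+F_{i-2} ⊂ F_i ⊂ ⋯ ⊂ F_n)
  newFlag : RawFlag → ℕ → Sub → RawFlag
  newFlag F i L = tabulate λ k →
    let p = suc (toℕ k) in
    if p <ᵇ i
      then (if p ≡ᵇ 1 then L else (L ⊕ pos F (p ∸ 1)))
      else lookup F k

  xq : RawFlag → FSum
  xq F = concatMap
    (λ m → let i = suc m in
      List.map (newFlag F i)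
        (filterᵇ (λ L → (L ⊆ᵇ pos F i) ∧ not (L ⊆ᵇ pos F (i ∸ 1))) (Gr 1)))
    (upTo n)

-- Write X_i(F) for the i-th summand of x^{(q)}(F), the sum over the lines L ⊆ F_i, L ⊈ F_{i-1}. It suffices to
-- show F · T_{s_{i-1}} ⋯ T_{s_1} = X_i(F) for every i, by induction on i. For i = 1 the only line is F_1. For the
-- step, F · T_{s_i} is the sum of the flags F′ obtained by replacing F_i with some G ≠ F_i, F_{i-1} ⊂ G ⊂ F_{i+1};
-- expanding each X_i(F′) and exchanging the sums over G and L, a line L ⊆ F_{i-1} contributes nothing, and a line
-- L ⊈ F_{i-1} contributes exactly through G = L + F_{i-1}, which is admissible iff L ⊆ F_{i+1} and L ⊈ F_i; the
-- resulting flag is the term of X_{i+1}(F) for L. That G = L + F_{i-1} is forced is a dimension count: over a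
-- finite field a subspace contained in another of the same dimension has as many vectors, so they coincide.

module Submission where

open import Defs
open import Data.Nat as ℕ using (ℕ; zero; suc; _+_; _≤_; _<_; _∸_; _<ᵇ_; _≡ᵇ_)
import Data.Nat.Properties as ℕP
open import Data.Bool using (Bool; true; false; _∧_; _∨_; not; if_then_else_; T)
open import Data.Bool.Properties using (T-∧; T-≡; T-not-≡; ∧-zeroʳ)
open import Data.Bool.ListAction using (and)
open import Data.List as List
  using (List; []; _∷_; [_]; _++_; concatMap; filterᵇ; length; map; upTo; cartesianProductWith)
import Data.List.Properties as ListP
open import Data.List.Membership.Propositional using (_∈_; lose)
import Data.List.Membership.Propositional.Properties as ∈P
open import Data.List.Membership.Propositional.Properties.WithK using (unique∧set⇒bag)
open import Data.List.Relation.Binary.BagAndSetEquality using (∼bag⇒↭)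
open import Data.List.Relation.Binary.Permutation.Propositional.Properties using (↭-length)
open import Data.List.Relation.Unary.Any as Any using (here; there)
open import Data.List.Relation.Unary.All as All using ([]; _∷_)
import Data.List.Relation.Unary.All.Properties as AllP
import Data.List.Relation.Unary.Any.Properties as AnyP
open import Data.List.Relation.Unary.AllPairs using (AllPairs; []; _∷_)
import Data.List.Relation.Unary.AllPairs.Properties as AllPairsP
open import Data.List.Relation.Unary.Unique.Propositional using (Unique)
import Data.List.Relation.Unary.Unique.Propositional.Properties as UniqueP
open import Data.Product using (Σ; ∃; _×_; _,_; proj₁; proj₂)
open import Data.Empty using (⊥-elim)
open import Function using (_∘_; _⇔_; mk⇔; Equivalence)
open import Relation.Binary.Bundles using (Setoid)
import Relation.Binary.Reasoning.Setoid as SetoidReasoning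
open import Data.Fin as Fin using (Fin; toℕ; fromℕ<)
import Data.Fin.Properties as FinP
open import Data.Vec using (Vec; []; _∷_; lookup; replicate)
import Data.Vec.Properties as VecP
open import Relation.Nullary using (¬_; yes; no; contradiction)
open import Relation.Binary.Definitions using (tri<; tri≈; tri>)
open import Relation.Nullary.Decidable using (T?; toWitness; fromWitness)
open import Relation.Binary.PropositionalEquality hiding ([_])
import Algebra.Properties.CommutativeSemigroup as CommSemigroupP
import Algebra.Properties.AbelianGroup as AbelianGroupP
import Algebra.Properties.Ring as RingP
open import Algebra.Bundles using (CommutativeRing)
open import Algebra.Structures using (IsCommutativeRing)

T-extensional : ∀ {a b} → (T a → T b) → (T b → T a) → a ≡ b
T-extensional {false} {false} _ _ = refl
T-extensional {false} {true}  _ g = ⊥-elim (g _)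
T-extensional {true}  {false} f _ = ⊥-elim (f _)
T-extensional {true}  {true}  _ _ = refl

T-∧⁻ : ∀ {a b} → T (a ∧ b) → T a × T b
T-∧⁻ = Equivalence.to T-∧

T-∧⁺ : ∀ {a b} → T a → T b → T (a ∧ b)
T-∧⁺ ta tb = Equivalence.from T-∧ (ta , tb)

T-not⁺ : ∀ {a} → ¬ T a → T (not a)
T-not⁺ {false} _ = _
T-not⁺ {true}  ¬a = ¬a _

T-not⁻ : ∀ {a} → T (not a) → ¬ T a
T-not⁻ {false} _ ()

T-→⁻ : ∀ {a b} → T (not a ∨ b) → T a → T b
T-→⁻ {true} tb _ = tb

T-→⁺ : ∀ {a b} → (T a → T b) → T (not a ∨ b)
T-→⁺ {false} _ = _
T-→⁺ {true}  f = f _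

¬T⇒≡false : ∀ {b} → ¬ T b → b ≡ false
¬T⇒≡false = Equivalence.to T-not-≡ ∘ T-not⁺

≡ᵇ-refl : ∀ m → (m ≡ᵇ m) ≡ true
≡ᵇ-refl m = Equivalence.to T-≡ (ℕP.≡⇒≡ᵇ m m refl)

≢⇒≡ᵇ-false : ∀ {m n} → m ≢ n → (m ≡ᵇ n) ≡ false
≢⇒≡ᵇ-false m≢n = ¬T⇒≡false (m≢n ∘ ℕP.≡ᵇ⇒≡ _ _)

<⇒<ᵇ-true : ∀ {m n} → m < n → (m <ᵇ n) ≡ true
<⇒<ᵇ-true m<n = Equivalence.to T-≡ (ℕP.<⇒<ᵇ m<n)

≥⇒<ᵇ-false : ∀ {m n} → n ≤ m → (m <ᵇ n) ≡ false
≥⇒<ᵇ-false n≤m = ¬T⇒≡false (ℕP.≤⇒≯ n≤m ∘ ℕP.<ᵇ⇒< _ _)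

_when_ : ∀ {A : Set} → List A → Bool → List A
xs when b = if b then xs else []

when-∧ : ∀ {A : Set} (xs : List A) a b → (xs when b) when a ≡ xs when (a ∧ b)
when-∧ xs false b = refl
when-∧ xs true  b = refl

concatMap-filterᵇ : ∀ {A B : Set} (f : A → List B) (p : A → Bool) xs →
  concatMap f (filterᵇ p xs) ≡ concatMap (λ x → f x when p x) xs
concatMap-filterᵇ f p []       = refl
concatMap-filterᵇ f p (x ∷ xs) with p x
... | true  = cong (f x ++_) (concatMap-filterᵇ f p xs)
... | false = concatMap-filterᵇ f p xs

map-filterᵇ : ∀ {A B : Set} (f : A → B) (p : A → Bool) xs →
  map f (filterᵇ p xs) ≡ concatMap (λ x → [ f x ] when p x) xs
map-filterᵇ f p xs = begin
  map f (filterᵇ p xs)                     ≡⟨ ListP.concatMap-pure (map f (filterᵇ p xs)) ⟨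
  concatMap [_] (map f (filterᵇ p xs))     ≡⟨ ListP.concatMap-map [_] f (filterᵇ p xs) ⟩
  concatMap ([_] ∘ f) (filterᵇ p xs)       ≡⟨ concatMap-filterᵇ ([_] ∘ f) p xs ⟩
  concatMap (λ x → [ f x ] when p x) xs    ∎
  where open ≡-Reasoning

concatMap-≡[] : ∀ {A B : Set} (f : A → List B) xs → (∀ {x} → x ∈ xs → f x ≡ []) → concatMap f xs ≡ []
concatMap-≡[] f [] _ = refl
concatMap-≡[] f (x ∷ xs) f≡[] rewrite f≡[] (here refl) = concatMap-≡[] f xs (f≡[] ∘ there)

when-concatMap : ∀ {A B : Set} (f : A → List B) xs b → concatMap f xs when b ≡ concatMap (λ x → f x when b) xs
when-concatMap f xs true  = refl
when-concatMap f xs false = sym (concatMap-≡[] _ xs λ _ → refl)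

map-filterᵇ-when : ∀ {A B : Set} (f : A → B) (p : A → Bool) xs b →
  map f (filterᵇ p xs) when b ≡ concatMap (λ x → [ f x ] when (b ∧ p x)) xs
map-filterᵇ-when f p xs b = begin
  map f (filterᵇ p xs) when b                     ≡⟨ cong (_when b) (map-filterᵇ f p xs) ⟩
  concatMap (λ x → [ f x ] when p x) xs when b    ≡⟨ when-concatMap _ xs b ⟩
  concatMap (λ x → ([ f x ] when p x) when b) xs  ≡⟨ ListP.concatMap-cong (λ x → when-∧ [ f x ] b (p x)) xs ⟩
  concatMap (λ x → [ f x ] when (b ∧ p x)) xs     ∎
  where open ≡-Reasoning

sumBy : ∀ {A : Set} → (A → ℕ) → List A → ℕ
sumBy f []       = 0
sumBy f (x ∷ xs) = f x + sumBy f xs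

sumBy-cong : ∀ {A : Set} {f g : A → ℕ} xs → (∀ {x} → x ∈ xs → f x ≡ g x) → sumBy f xs ≡ sumBy g xs
sumBy-cong []       _   = refl
sumBy-cong (x ∷ xs) f≗g = cong₂ _+_ (f≗g (here refl)) (sumBy-cong xs (f≗g ∘ there))

sumBy-zero : ∀ {A : Set} (xs : List A) → sumBy (λ _ → 0) xs ≡ 0
sumBy-zero []       = refl
sumBy-zero (x ∷ xs) = sumBy-zero xs

sumBy-+ : ∀ {A : Set} (f g : A → ℕ) xs → sumBy (λ x → f x + g x) xs ≡ sumBy f xs + sumBy g xs
sumBy-+ f g []       = refl
sumBy-+ f g (x ∷ xs) = begin
  f x + g x + sumBy (λ x → f x + g x) xs  ≡⟨ cong (f x + g x +_) (sumBy-+ f g xs) ⟩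
  f x + g x + (sumBy f xs + sumBy g xs)    ≡⟨ CommSemigroupP.interchange ℕP.+-commutativeSemigroup (f x) (g x) _ _ ⟩
  f x + sumBy f xs + (g x + sumBy g xs)    ∎
  where open ≡-Reasoning

sumBy-comm : ∀ {A B : Set} (h : A → B → ℕ) xs ys →
  sumBy (λ x → sumBy (h x) ys) xs ≡ sumBy (λ y → sumBy (λ x → h x y) xs) ys
sumBy-comm h []       ys = sym (sumBy-zero ys)
sumBy-comm h (x ∷ xs) ys = begin
  sumBy (h x) ys + sumBy (λ x → sumBy (h x) ys) xs            ≡⟨ cong (sumBy (h x) ys +_) (sumBy-comm h xs ys) ⟩
  sumBy (h x) ys + sumBy (λ y → sumBy (λ x → h x y) xs) ys    ≡⟨ sym (sumBy-+ (h x) _ ys) ⟩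
  sumBy (λ y → h x y + sumBy (λ x → h x y) xs) ys             ∎
  where open ≡-Reasoning

filterᵇ-absorb : ∀ {A : Set} {p r : A → Bool} → (∀ {x} → T (p x) → T (r x)) →
  ∀ xs → filterᵇ p (filterᵇ r xs) ≡ filterᵇ p xs
filterᵇ-absorb p⇒r [] = refl
filterᵇ-absorb {p = p} {r} p⇒r (x ∷ xs) with r x in rx
... | true with p x
...   | true  = cong (x ∷_) (filterᵇ-absorb p⇒r xs)
...   | false = filterᵇ-absorb p⇒r xs
filterᵇ-absorb {p = p} {r} p⇒r (x ∷ xs) | false with p x in px
...   | true  = ⊥-elim (subst T rx (p⇒r (subst T (sym px) _)))
...   | false = filterᵇ-absorb p⇒r xs

unique∧set⇒length≡ : ∀ {A : Set} {xs ys : List A} → Unique xs → Unique ys →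
  (∀ {z} → z ∈ xs ⇔ z ∈ ys) → length xs ≡ length ys
unique∧set⇒length≡ uxs uys xs⇔ys = ↭-length (∼bag⇒↭ (unique∧set⇒bag uxs uys xs⇔ys))

cartesianProductWith-∷ : ∀ {A : Set} {m} (W : List (Vec A m)) xs →
  concatMap (λ a → map (a ∷_) W) xs ≡ cartesianProductWith _∷_ xs W
cartesianProductWith-∷ W []       = refl
cartesianProductWith-∷ W (x ∷ xs) = cong (map (x ∷_) W ++_) (cartesianProductWith-∷ W xs)

∈-vecsOver : ∀ {A : Set} {xs : List A} → (∀ a → a ∈ xs) → ∀ {m} (v : Vec A m) → v ∈ vecsOver xs m
∈-vecsOver all∈ []      = here refl
∈-vecsOver {xs = xs} all∈ (a ∷ v) =
  subst (_ ∈_) (sym (cartesianProductWith-∷ (vecsOver xs _) xs))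
    (∈P.∈-cartesianProductWith⁺ _∷_ (all∈ a) (∈-vecsOver all∈ v))

vecsOver-unique : ∀ {A : Set} {xs : List A} → Unique xs → ∀ m → Unique (vecsOver xs m)
vecsOver-unique uxs zero    = [] ∷ []
vecsOver-unique {xs = xs} uxs (suc m) =
  subst Unique (sym (cartesianProductWith-∷ (vecsOver xs m) xs))
    (UniqueP.cartesianProductWith⁺ _∷_ VecP.∷-injective uxs (vecsOver-unique uxs m))

module Multiplicity {A : Set} (_==_ : A → A → Bool) where

  mult : A → List A → ℕ
  mult x xs = length (filterᵇ (x ==_) xs)

  infix 4 _≋_
  _≋_ : List A → List A → Set
  xs ≋ ys = ∀ x → mult x xs ≡ mult x ys

  ≋-setoid : Setoid _ _
  ≋-setoid = record
    { Carrier = List A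
    ; _≈_ = _≋_
    ; isEquivalence = record
      { refl = λ _ → refl ; sym = λ eq x → sym (eq x) ; trans = λ eq eq′ x → trans (eq x) (eq′ x) } }

  mult-++ : ∀ x xs ys → mult x (xs ++ ys) ≡ mult x xs + mult x ys
  mult-++ x xs ys = trans (cong length (ListP.filter-++ (T? ∘ (x ==_)) xs ys))
                         (ListP.length-++ (filterᵇ (x ==_) xs))

  mult-concatMap : ∀ {B : Set} x (f : B → List A) ys → mult x (concatMap f ys) ≡ sumBy (mult x ∘ f) ys
  mult-concatMap x f []       = refl
  mult-concatMap x f (y ∷ ys) =
    trans (mult-++ x (f y) (concatMap f ys)) (cong (mult x (f y) +_) (mult-concatMap x f ys))

  when⁺ : ∀ {xs ys} b → (T b → xs ≋ ys) → xs when b ≋ ys when b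
  when⁺ false _  _ = refl
  when⁺ true  eq   = eq _

  open Setoid ≋-setoid public using () renaming (reflexive to ≡⇒≋)

  concatMap⁺ : ∀ {B : Set} {f g : B → List A} ys → (∀ {y} → y ∈ ys → f y ≋ g y) →
    concatMap f ys ≋ concatMap g ys
  concatMap⁺ {f = f} {g} ys f≋g x = begin
    mult x (concatMap f ys)    ≡⟨ mult-concatMap x f ys ⟩
    sumBy (mult x ∘ f) ys      ≡⟨ sumBy-cong ys (λ y∈ys → f≋g y∈ys x) ⟩
    sumBy (mult x ∘ g) ys      ≡⟨ sym (mult-concatMap x g ys) ⟩
    mult x (concatMap g ys)    ∎
    where open ≡-Reasoning

  concatMap-comm : ∀ {B C : Set} (k : B → C → List A) ys zs →
    concatMap (λ y → concatMap (k y) zs) ys ≋ concatMap (λ z → concatMap (λ y → k y z) ys) zs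
  concatMap-comm k ys zs x = begin
    mult x (concatMap (λ y → concatMap (k y) zs) ys)
      ≡⟨ mult-concatMap x _ ys ⟩
    sumBy (λ y → mult x (concatMap (k y) zs)) ys
      ≡⟨ sumBy-cong ys (λ {y} _ → mult-concatMap x (k y) zs) ⟩
    sumBy (λ y → sumBy (λ z → mult x (k y z)) zs) ys
      ≡⟨ sumBy-comm (λ y z → mult x (k y z)) ys zs ⟩
    sumBy (λ z → sumBy (λ y → mult x (k y z)) ys) zs
      ≡⟨ sumBy-cong zs (λ {z} _ → sym (mult-concatMap x (λ y → k y z) ys)) ⟩
    sumBy (λ z → mult x (concatMap (λ y → k y z) ys)) zs
      ≡⟨ sym (mult-concatMap x _ zs) ⟩
    mult x (concatMap (λ z → concatMap (λ y → k y z) ys) zs)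
      ∎
    where open ≡-Reasoning

module VectorLaws {q : ℕ} (K : FieldOn q) where
  open FieldOn K renaming (_+_ to infixl 6 _+ᶠ_; _*_ to infixl 7 _*ᶠ_)

  module _ {m : ℕ} where
    open FlagTheory K m public using (0V; _+V_; _-V_; _·V_)

  private variable m : ℕ
  open IsCommutativeRing isCommutativeRing
    using (+-identityˡ; +-identityʳ; +-assoc; -‿inverseʳ; distribˡ; distribʳ;
           *-assoc; *-comm; *-identityˡ; zeroˡ; zeroʳ)

  private
    ring : CommutativeRing _ _
    ring = record { isCommutativeRing = isCommutativeRing }

  open RingP (CommutativeRing.ring ring)
    using (-0#≈0#; -‿distribˡ-*; -‿distribʳ-*; -‿+-comm; x∙y⁻¹≈ε⇒x≈y; +-inverseˡ-unique)
  open AbelianGroupP (CommutativeRing.+-abelianGroup ring) using (xyx⁻¹≈y)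

  +-interchange : ∀ a b c d → (a +ᶠ b) +ᶠ (c +ᶠ d) ≡ (a +ᶠ c) +ᶠ (b +ᶠ d)
  +-interchange = CommSemigroupP.interchange (CommutativeRing.+-commutativeSemigroup ring)

  +V-identityˡ : (u : Vec (Fin q) m) → 0V +V u ≡ u
  +V-identityˡ = VecP.zipWith-identityˡ +-identityˡ

  +V-identityʳ : (u : Vec (Fin q) m) → u +V 0V ≡ u
  +V-identityʳ = VecP.zipWith-identityʳ +-identityʳ

  +V-interchange : (u v w z : Vec (Fin q) m) → (u +V v) +V (w +V z) ≡ (u +V w) +V (v +V z)
  +V-interchange []       []       []       []       = refl
  +V-interchange (a ∷ u) (b ∷ v) (c ∷ w) (d ∷ z) = cong₂ _∷_ (+-interchange a b c d) (+V-interchange u v w z)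

  -V-interchange : (u v w z : Vec (Fin q) m) → (u -V v) +V (w -V z) ≡ (u +V w) -V (v +V z)
  -V-interchange []       []       []       []       = refl
  -V-interchange (a ∷ u) (b ∷ v) (c ∷ w) (d ∷ z) =
    cong₂ _∷_ (trans (+-interchange a (- b) c (- d)) (cong ((a +ᶠ c) +ᶠ_) (-‿+-comm b d)))
              (-V-interchange u v w z)

  +V-sub-cancel : (u v : Vec (Fin q) m) → u +V (v -V u) ≡ v
  +V-sub-cancel []      []      = refl
  +V-sub-cancel (a ∷ u) (b ∷ v) = cong₂ _∷_ (trans (sym (+-assoc a b (- a))) (xyx⁻¹≈y a b)) (+V-sub-cancel u v)

  +V-sub-cancelˡ : (u v : Vec (Fin q) m) → (u +V v) -V u ≡ v
  +V-sub-cancelˡ []      []      = refl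
  +V-sub-cancelˡ (a ∷ u) (b ∷ v) = cong₂ _∷_ (xyx⁻¹≈y a b) (+V-sub-cancelˡ u v)

  -V-self : (u : Vec (Fin q) m) → u -V u ≡ 0V
  -V-self []      = refl
  -V-self (a ∷ u) = cong₂ _∷_ (-‿inverseʳ a) (-V-self u)

  -V-identityʳ : (u : Vec (Fin q) m) → u -V 0V ≡ u
  -V-identityʳ []      = refl
  -V-identityʳ (a ∷ u) = cong₂ _∷_ (trans (cong (a +ᶠ_) -0#≈0#) (+-identityʳ a)) (-V-identityʳ u)

  -V≡0V⇒≡ : (u v : Vec (Fin q) m) → u -V v ≡ 0V → u ≡ v
  -V≡0V⇒≡ []      []      _  = refl
  -V≡0V⇒≡ (a ∷ u) (b ∷ v) eq =
    cong₂ _∷_ (x∙y⁻¹≈ε⇒x≈y a b (VecP.∷-injectiveˡ eq)) (-V≡0V⇒≡ u v (VecP.∷-injectiveʳ eq))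

  ·V-zeroˡ : (u : Vec (Fin q) m) → 0# ·V u ≡ 0V
  ·V-zeroˡ []      = refl
  ·V-zeroˡ (a ∷ u) = cong₂ _∷_ (zeroˡ a) (·V-zeroˡ u)

  ·V-zeroʳ : ∀ c → c ·V 0V {m} ≡ 0V
  ·V-zeroʳ {m} c = trans (VecP.map-replicate (c *ᶠ_) 0# m) (cong (replicate m) (zeroʳ c))

  ·V-identityˡ : (u : Vec (Fin q) m) → 1# ·V u ≡ u
  ·V-identityˡ []      = refl
  ·V-identityˡ (a ∷ u) = cong₂ _∷_ (*-identityˡ a) (·V-identityˡ u)

  ·V-assoc : ∀ c d (u : Vec (Fin q) m) → (c *ᶠ d) ·V u ≡ c ·V (d ·V u)
  ·V-assoc c d []      = refl
  ·V-assoc c d (a ∷ u) = cong₂ _∷_ (*-assoc c d a) (·V-assoc c d u)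

  ·V-distribˡ : ∀ c (u v : Vec (Fin q) m) → c ·V (u +V v) ≡ (c ·V u) +V (c ·V v)
  ·V-distribˡ c []      []      = refl
  ·V-distribˡ c (a ∷ u) (b ∷ v) = cong₂ _∷_ (distribˡ c a b) (·V-distribˡ c u v)

  ·V-distribʳ : ∀ c d (u : Vec (Fin q) m) → (c +ᶠ d) ·V u ≡ (c ·V u) +V (d ·V u)
  ·V-distribʳ c d []      = refl
  ·V-distribʳ c d (a ∷ u) = cong₂ _∷_ (distribʳ a c d) (·V-distribʳ c d u)

  ·V-distribʳ-sub : ∀ c d (u : Vec (Fin q) m) → (c +ᶠ (- d)) ·V u ≡ (c ·V u) -V (d ·V u)
  ·V-distribʳ-sub c d []      = refl
  ·V-distribʳ-sub c d (a ∷ u) =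
    cong₂ _∷_ (trans (distribʳ a c (- d)) (cong ((c *ᶠ a) +ᶠ_) (sym (-‿distribˡ-* d a))))
              (·V-distribʳ-sub c d u)

  cw+l≡0⇒w≡-yl : ∀ c y (w l : Vec (Fin q) m) → c *ᶠ y ≡ 1# → (c ·V w) +V l ≡ 0V → w ≡ (- y) ·V l
  cw+l≡0⇒w≡-yl c y []      []      _   _  = refl
  cw+l≡0⇒w≡-yl c y (a ∷ w) (b ∷ l) c*y≡1 eq =
    cong₂ _∷_ a≡-yb (cw+l≡0⇒w≡-yl c y w l c*y≡1 (VecP.∷-injectiveʳ eq))
    where
    open ≡-Reasoning
    a≡-yb : a ≡ (- y) *ᶠ b
    a≡-yb = begin
      a              ≡⟨ sym (*-identityˡ a) ⟩
      1# *ᶠ a        ≡⟨ cong (_*ᶠ a) (trans (sym c*y≡1) (*-comm c y)) ⟩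
      y *ᶠ c *ᶠ a    ≡⟨ *-assoc y c a ⟩
      y *ᶠ (c *ᶠ a)  ≡⟨ cong (y *ᶠ_) (+-inverseˡ-unique (c *ᶠ a) b (VecP.∷-injectiveˡ eq)) ⟩
      y *ᶠ (- b)     ≡⟨ sym (-‿distribʳ-* y b) ⟩
      - (y *ᶠ b)     ≡⟨ -‿distribˡ-* y b ⟩
      (- y) *ᶠ b     ∎

module Subspaces {q : ℕ} (K : FieldOn q) (n : ℕ) where
  open FieldOn K using (0#; 1#; -_; 0≢1; inverse)
  open FlagTheory K n hiding (0V; _+V_; _-V_; _·V_)
  open VectorLaws K

  infix 4 _⊆ₛ_
  _⊆ₛ_ : Sub → Sub → Set
  S ⊆ₛ S′ = ∀ {v} → T (S v) → T (S′ v)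

  HasBasis : Sub → ℕ → Set
  HasBasis S d = Σ (Vec V d) λ bs → T (indep bs) × span bs ≗ S

  ∈-elems : ∀ a → a ∈ elems
  ∈-elems = ∈P.∈-allFin

  ∈-allV : ∀ v → v ∈ allV
  ∈-allV = ∈-vecsOver ∈-elems

  ∈-coefficients : ∀ {d} (c : Vec (Fin q) d) → c ∈ vecsOver elems d
  ∈-coefficients = ∈-vecsOver ∈-elems

  ⊆ᵇ⁻ : ∀ {S S′} → T (S ⊆ᵇ S′) → S ⊆ₛ S′
  ⊆ᵇ⁻ {S} {S′} h {v} = T-→⁻ (All.lookup (AllP.all⁺ (λ v → not (S v) ∨ S′ v) allV h) (∈-allV v))

  ⊆ᵇ⁺ : ∀ {S S′} → S ⊆ₛ S′ → T (S ⊆ᵇ S′)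
  ⊆ᵇ⁺ {S} {S′} S⊆S′ =
    AllP.all⁻ (λ v → not (S v) ∨ S′ v) {xs = allV} (All.tabulate λ {v} _ → T-→⁺ {S v} (S⊆S′ {v}))

  ≐⁻ : ∀ {S S′} → T (S ≐ S′) → S ≗ S′
  ≐⁻ {S} {S′} h v = let S⊆S′ , S′⊆S = T-∧⁻ h
                    in T-extensional (⊆ᵇ⁻ {S} S⊆S′) (⊆ᵇ⁻ {S′} S′⊆S)

  ≐⁺ : ∀ {S S′} → S ≗ S′ → T (S ≐ S′)
  ≐⁺ {S} {S′} S≗S′ =
    T-∧⁺ (⊆ᵇ⁺ {S} λ {v} → subst T (S≗S′ v)) (⊆ᵇ⁺ {S′} λ {v} → subst T (sym (S≗S′ v)))

  span⁻ : ∀ {d} (bs : Vec V d) {v} → T (span bs v) → ∃ λ c → lin c bs ≡ v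
  span⁻ {d} bs {v} h = let c , c≡ = Any.satisfied (AnyP.any⁻ (λ c → lin c bs ≟V v) (vecsOver elems d) h)
                       in c , toWitness c≡

  span⁺ : ∀ {d} (bs : Vec V d) c → T (span bs (lin c bs))
  span⁺ bs c = AnyP.any⁺ (λ c′ → lin c′ bs ≟V lin c bs) (lose (∈-coefficients c) (fromWitness refl))

  private
    independence-test : ∀ {d} → Vec V d → Vec (Fin q) d → Bool
    independence-test {d} bs c = not (lin c bs ≟V 0V) ∨ (c ≟V replicate d 0#)

  indep⁻ : ∀ {d} {bs : Vec V d} → T (indep bs) → ∀ c → lin c bs ≡ 0V → c ≡ 0V
  indep⁻ {d} {bs} h c lin≡0 =
    toWitness (T-→⁻ {lin c bs ≟V 0V}
                (All.lookup (AllP.all⁺ (independence-test bs) (vecsOver elems d) h) (∈-coefficients c))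
                (fromWitness lin≡0))

  indep⁺ : ∀ {d} {bs : Vec V d} → (∀ c → lin c bs ≡ 0V → c ≡ 0V) → T (indep bs)
  indep⁺ {bs = bs} h =
    AllP.all⁻ (independence-test bs) {xs = vecsOver elems _}
      (All.tabulate λ {c} _ → T-→⁺ {lin c bs ≟V 0V} λ lin≡0 → fromWitness (h c (toWitness lin≡0)))

  ⊕⁻ : ∀ {S S′ v} → T ((S ⊕ S′) v) → ∃ λ a → T (S a) × T (S′ (v -V a))
  ⊕⁻ {S} {S′} {v} h = let a , Sa∧S′ = Any.satisfied (AnyP.any⁻ (λ a → S a ∧ S′ (v -V a)) allV h)
                      in a , T-∧⁻ Sa∧S′

  ⊕⁺ : ∀ {S S′ v} a → T (S a) → T (S′ (v -V a)) → T ((S ⊕ S′) v)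
  ⊕⁺ {S} {S′} {v} a Sa S′v-a = AnyP.any⁺ (λ a → S a ∧ S′ (v -V a)) (lose (∈-allV a) (T-∧⁺ Sa S′v-a))

  lin-add : ∀ {d} (c c′ : Vec (Fin q) d) bs → lin (c +V c′) bs ≡ lin c bs +V lin c′ bs
  lin-add []      []        []       = sym (+V-identityˡ 0V)
  lin-add (a ∷ c) (a′ ∷ c′) (b ∷ bs) =
    trans (cong₂ _+V_ (·V-distribʳ a a′ b) (lin-add c c′ bs)) (+V-interchange _ _ _ _)

  lin-sub : ∀ {d} (c c′ : Vec (Fin q) d) bs → lin (c -V c′) bs ≡ lin c bs -V lin c′ bs
  lin-sub []      []        []       = sym (-V-self 0V)
  lin-sub (a ∷ c) (a′ ∷ c′) (b ∷ bs) =
    trans (cong₂ _+V_ (·V-distribʳ-sub a a′ b) (lin-sub c c′ bs)) (-V-interchange _ _ _ _)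

  lin-scale : ∀ {d} a (c : Vec (Fin q) d) bs → lin (a ·V c) bs ≡ a ·V lin c bs
  lin-scale a []       []       = sym (·V-zeroʳ a)
  lin-scale a (a′ ∷ c) (b ∷ bs) =
    trans (cong₂ _+V_ (·V-assoc a a′ b) (lin-scale a c bs)) (sym (·V-distribˡ a _ _))

  lin-zero : ∀ {d} (bs : Vec V d) → lin 0V bs ≡ 0V
  lin-zero []       = refl
  lin-zero (b ∷ bs) = trans (cong₂ _+V_ (·V-zeroˡ b) (lin-zero bs)) (+V-identityˡ 0V)

  lin-injective : ∀ {d} {bs : Vec V d} → T (indep bs) → ∀ {c c′} → lin c bs ≡ lin c′ bs → c ≡ c′
  lin-injective {bs = bs} ind {c} {c′} eq = -V≡0V⇒≡ c c′ (indep⁻ ind (c -V c′)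
    (trans (lin-sub c c′ bs) (trans (cong (_-V lin c′ bs) eq) (-V-self _))))

  module _ {S d} (hS : HasBasis S d) where
    private
      bs = proj₁ hS

    lin∈ : ∀ c → T (S (lin c bs))
    lin∈ c = subst T (proj₂ (proj₂ hS) _) (span⁺ bs c)

    ∈⇒lin : ∀ {v} → T (S v) → ∃ λ c → lin c bs ≡ v
    ∈⇒lin {v} Sv = span⁻ bs (subst T (sym (proj₂ (proj₂ hS) v)) Sv)

    0V∈ : T (S 0V)
    0V∈ = subst (T ∘ S) (lin-zero bs) (lin∈ 0V)

    +V-closed : ∀ {u v} → T (S u) → T (S v) → T (S (u +V v))
    +V-closed Su Sv with ∈⇒lin Su | ∈⇒lin Sv
    ... | c , refl | c′ , refl = subst (T ∘ S) (lin-add c c′ bs) (lin∈ (c +V c′))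

    ·V-closed : ∀ a {v} → T (S v) → T (S (a ·V v))
    ·V-closed a Sv with ∈⇒lin Sv
    ... | c , refl = subst (T ∘ S) (lin-scale a c bs) (lin∈ (a ·V c))

  ⊕-least : ∀ {L F G d} → HasBasis G d → L ⊆ₛ G → F ⊆ₛ G → L ⊕ F ⊆ₛ G
  ⊕-least {L} {F} {G} hG L⊆G F⊆G {v} L⊕Fv with ⊕⁻ {L} {F} L⊕Fv
  ... | a , La , Fv-a = subst (T ∘ G) (+V-sub-cancel a v) (+V-closed hG (L⊆G La) (F⊆G Fv-a))

  ⊆-⊕ˡ : ∀ {L F d} → HasBasis F d → L ⊆ₛ L ⊕ F
  ⊆-⊕ˡ {L} {F} hF {v} Lv = ⊕⁺ {L} {F} v Lv (subst (T ∘ F) (sym (-V-self v)) (0V∈ hF))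

  ⊆-⊕ʳ : ∀ {L F d} → HasBasis L d → F ⊆ₛ L ⊕ F
  ⊆-⊕ʳ {L} {F} hL {v} Fv = ⊕⁺ {L} {F} 0V (0V∈ hL) (subst (T ∘ F) (sym (-V-identityʳ v)) Fv)

  zeroSub-basis : HasBasis zeroSub 0
  zeroSub-basis = [] , indep⁺ {bs = []} (λ { [] _ → refl }) , λ v → T-extensional (to v) (from v)
    where
    to : ∀ v → T (span [] v) → T (zeroSub v)
    to v h with span⁻ [] h
    ... | [] , refl = fromWitness refl
    from : ∀ v → T (zeroSub v) → T (span [] v)
    from v h rewrite toWitness h = span⁺ [] []

  ⊕-identityʳ : ∀ L → L ⊕ zeroSub ≗ L
  ⊕-identityʳ L v = T-extensional to (⊆-⊕ˡ {L} zeroSub-basis)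
    where
    to : T ((L ⊕ zeroSub) v) → T (L v)
    to h with ⊕⁻ {L} {zeroSub} h
    ... | a , La , v-a≡0 rewrite -V≡0V⇒≡ v a (toWitness v-a≡0) = La

  module _ {L w} (span[w]≗L : span (w ∷ []) ≗ L) where

    line-⁺ : ∀ c → T (L (c ·V w))
    line-⁺ c = subst T (span[w]≗L _) (subst (T ∘ span (w ∷ [])) (+V-identityʳ _) (span⁺ (w ∷ []) (c ∷ [])))

    line-∋ : T (L w)
    line-∋ = subst (T ∘ L) (·V-identityˡ w) (line-⁺ 1#)

    line-⁻ : ∀ {v} → T (L v) → ∃ λ c → c ·V w ≡ v
    line-⁻ {v} Lv with span⁻ (w ∷ []) (subst T (sym (span[w]≗L v)) Lv)
    ... | c ∷ [] , refl = c , sym (+V-identityʳ _)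

    line-⊆ : ∀ {G d} → HasBasis G d → T (G w) → L ⊆ₛ G
    line-⊆ {G} hG Gw Lv with line-⁻ Lv
    ... | c , refl = ·V-closed hG c Gw

  line-nonzero : ∀ {w} → T (indep (w ∷ [])) → w ≢ 0V
  line-nonzero ind refl =
    0≢1 (sym (VecP.∷-injectiveˡ (indep⁻ ind (1# ∷ []) (trans (+V-identityʳ _) (·V-identityˡ 0V)))))

  extend-indep : ∀ {F w d} (hF : HasBasis F d) → ¬ T (F w) → T (indep (w ∷ proj₁ hF))
  extend-indep {F} {w} hF@(bs , ind , _) w∉F = indep⁺ {bs = w ∷ bs} independent
    where
    independent : ∀ c → lin c (w ∷ bs) ≡ 0V → c ≡ 0V
    independent (a ∷ c) lin≡0 with a FinP.≟ 0#
    ... | yes refl =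
      cong (0# ∷_) (indep⁻ ind c (trans (sym (trans (cong (_+V lin c bs) (·V-zeroˡ w)) (+V-identityˡ _))) lin≡0))
    ... | no a≢0 with inverse a a≢0
    ... | y , a*y≡1 = ⊥-elim (w∉F (subst (T ∘ F) (sym w≡) (lin∈ hF ((- y) ·V c))))
      where
      w≡ : w ≡ lin ((- y) ·V c) bs
      w≡ = trans (cw+l≡0⇒w≡-yl a y w (lin c bs) a*y≡1 lin≡0) (sym (lin-scale (- y) c bs))

  extend-span : ∀ {L F w d} (hF : HasBasis F d) → span (w ∷ []) ≗ L → span (w ∷ proj₁ hF) ≗ L ⊕ F
  extend-span {L} {F} {w} hF@(bs , _ , _) span[w]≗L v = T-extensional to from
    where
    to : T (span (w ∷ bs) v) → T ((L ⊕ F) v)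
    to h with span⁻ (w ∷ bs) h
    ... | a ∷ c , refl =
      ⊕⁺ {L} {F} (a ·V w) (line-⁺ span[w]≗L a) (subst (T ∘ F) (sym (+V-sub-cancelˡ _ _)) (lin∈ hF c))
    from : T ((L ⊕ F) v) → T (span (w ∷ bs) v)
    from h with ⊕⁻ {L} {F} h
    ... | a , La , Fv-a with line-⁻ span[w]≗L La | ∈⇒lin hF Fv-a
    ... | c , refl | c′ , lin≡ =
      subst (T ∘ span (w ∷ bs)) (trans (cong ((c ·V w) +V_) lin≡) (+V-sub-cancel _ v))
        (span⁺ (w ∷ bs) (c ∷ c′))

  extend-basis : ∀ {L F w d} → HasBasis F d → span (w ∷ []) ≗ L → ¬ T (F w) → HasBasis (L ⊕ F) (suc d)
  extend-basis {w = w} hF span[w]≗L w∉F = w ∷ proj₁ hF , extend-indep hF w∉F , extend-span hF span[w]≗L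

  line-⊕-basis : ∀ {L F d} → HasBasis L 1 → HasBasis F d → ¬ L ⊆ₛ F → HasBasis (L ⊕ F) (suc d)
  line-⊕-basis (w ∷ [] , _ , span[w]≗L) hF L⊈F = extend-basis hF span[w]≗L (L⊈F ∘ line-⊆ span[w]≗L hF)

  count : Sub → ℕ
  count S = length (filterᵇ S allV)

  count-span : ∀ {d} {bs : Vec V d} → T (indep bs) → count (span bs) ≡ length (vecsOver elems d)
  count-span {d} {bs} ind = begin
    count (span bs)
      ≡⟨ unique∧set⇒length≡ unique-vectors unique-combinations (mk⇔ to from) ⟩
    length (map (λ c → lin c bs) (vecsOver elems d))
      ≡⟨ ListP.length-map _ (vecsOver elems d) ⟩
    length (vecsOver elems d)
      ∎
    where
    open ≡-Reasoning
    unique-vectors : Unique (filterᵇ (span bs) allV)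
    unique-vectors = UniqueP.filter⁺ (T? ∘ span bs) (vecsOver-unique (UniqueP.allFin⁺ q) n)
    unique-combinations : Unique (map (λ c → lin c bs) (vecsOver elems d))
    unique-combinations = UniqueP.map⁺ (lin-injective ind) (vecsOver-unique (UniqueP.allFin⁺ q) d)
    to : ∀ {v} → v ∈ filterᵇ (span bs) allV → v ∈ map (λ c → lin c bs) (vecsOver elems d)
    to v∈ with span⁻ bs (proj₂ (∈P.∈-filter⁻ (T? ∘ span bs) {xs = allV} v∈))
    ... | c , refl = ∈P.∈-map⁺ _ (∈-coefficients c)
    from : ∀ {v} → v ∈ map (λ c → lin c bs) (vecsOver elems d) → v ∈ filterᵇ (span bs) allV
    from v∈ with ∈P.∈-map⁻ _ v∈
    ... | c , _ , refl = ∈P.∈-filter⁺ (T? ∘ span bs) (∈-allV _) (span⁺ bs c)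

  count-basis : ∀ {S d} → HasBasis S d → count S ≡ length (vecsOver elems d)
  count-basis {S} (bs , ind , span≗S) =
    trans (cong length (ListP.filter-≐ (T? ∘ S) (T? ∘ span bs) (S⊆span , span⊆S) allV)) (count-span {bs = bs} ind)
    where
    S⊆span : S ⊆ₛ span bs
    S⊆span {v} = subst T (sym (span≗S v))
    span⊆S : span bs ⊆ₛ S
    span⊆S {v} = subst T (span≗S v)

  -- Over a finite field, subspaces of equal dimension have equally many vectors.
  equal-dim-⊆⇒≗ : ∀ {S S′ d} → HasBasis S d → HasBasis S′ d → S ⊆ₛ S′ → S ≗ S′
  equal-dim-⊆⇒≗ {S} {S′} hS hS′ S⊆S′ v = T-extensional S⊆S′ S′⊆S
    where
    S′⊆S : T (S′ v) → T (S v)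
    S′⊆S S′v with S v in Sv≡
    ... | true  = _
    ... | false = contradiction same-count (ℕP.<⇒≢ fewer)
      where
      ys = filterᵇ S′ allV
      fewer : length (filterᵇ S ys) < length ys
      fewer = ListP.filter-notAll (T? ∘ S) ys
        (Any.map (λ { refl → subst T Sv≡ }) (∈P.∈-filter⁺ (T? ∘ S′) (∈-allV v) S′v))
      same-count : length (filterᵇ S ys) ≡ length ys
      same-count = trans (cong length (filterᵇ-absorb S⊆S′ allV)) (trans (count-basis hS) (sym (count-basis hS′)))

  Distinct : List Sub → Set
  Distinct = AllPairs (λ S S′ → ¬ T (S ≐ S′))

  dedup-⊆ : ∀ Ss {S} → S ∈ dedup Ss → S ∈ Ss
  dedup-⊆ (S ∷ Ss) (here refl) = here refl
  dedup-⊆ (S ∷ Ss) (there S∈) = there (dedup-⊆ Ss (proj₁ (∈P.∈-filter⁻ (T? ∘ (not ∘ (S ≐_))) S∈)))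

  dedup-distinct : ∀ Ss → Distinct (dedup Ss)
  dedup-distinct []       = []
  dedup-distinct (S ∷ Ss) =
    All.tabulate (λ S′∈ → T-not⁻ (proj₂ (∈P.∈-filter⁻ (T? ∘ (not ∘ (S ≐_))) {xs = dedup Ss} S′∈)))
    ∷ AllPairsP.filter⁺ (T? ∘ (not ∘ (S ≐_))) (dedup-distinct Ss)

  dedup-complete : ∀ Ss {S} → S ∈ Ss → ∃ λ S′ → S′ ∈ dedup Ss × S′ ≗ S
  dedup-complete (S ∷ Ss) (here refl) = S , here refl , λ _ → refl
  dedup-complete (S ∷ Ss) (there S∈) with dedup-complete Ss S∈
  ... | S′ , S′∈ , S′≗ with T? (S ≐ S′)
  ... | yes S≐S′ = S , here refl , λ v → trans (≐⁻ {S} {S′} S≐S′ v) (S′≗ v)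
  ... | no  S≉S′ = S′ , there (∈P.∈-filter⁺ (T? ∘ (not ∘ (S ≐_))) S′∈ (T-not⁺ S≉S′)) , S′≗

  Gr-basis : ∀ {d G} → G ∈ Gr d → HasBasis G d
  Gr-basis {d} G∈ with ∈P.∈-map⁻ span (dedup-⊆ _ G∈)
  ... | bs , bs∈ , refl = bs , proj₂ (∈P.∈-filter⁻ (T? ∘ indep) {xs = vecsOver allV d} bs∈) , λ _ → refl

  Gr-complete : ∀ {S d} → HasBasis S d → ∃ λ G → G ∈ Gr d × G ≗ S
  Gr-complete (bs , ind , span≗S)
    with dedup-complete _ (∈P.∈-map⁺ span (∈P.∈-filter⁺ (T? ∘ indep) (∈-vecsOver ∈-allV bs) ind))
  ... | G , G∈ , G≗ = G , G∈ , λ v → trans (G≗ v) (span≗S v)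

  -- The combinatorial core: among the G ≠ B with A ⊂ G ⊂ C, a line L ⊈ A lies in exactly one, G = L + A,
  -- and that G qualifies iff L ⊆ C and L ⊈ B.
  neighbour-through-line : ∀ {A B C G L m} →
    HasBasis A m → HasBasis B (suc m) → HasBasis C (suc (suc m)) → A ⊆ₛ B → B ⊆ₛ C →
    HasBasis G (suc m) → HasBasis L 1 → ¬ L ⊆ₛ A →
    ((A ⊆ᵇ G) ∧ (G ⊆ᵇ C) ∧ not (G ≐ B)) ∧ ((L ⊆ᵇ G) ∧ not (L ⊆ᵇ A))
      ≡ (G ≐ (L ⊕ A)) ∧ ((L ⊆ᵇ C) ∧ not (L ⊆ᵇ B))
  neighbour-through-line {A} {B} {C} {G} {L} {m} hA hB hC A⊆B B⊆C hG hL L⊈A =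
    T-extensional to from
    where
    L⊕A-fills : ∀ {S} → HasBasis S (suc m) → L ⊆ₛ S → A ⊆ₛ S → L ⊕ A ≗ S
    L⊕A-fills hS L⊆S A⊆S =
      equal-dim-⊆⇒≗ (line-⊕-basis hL hA L⊈A) hS (⊕-least hS L⊆S A⊆S)

    to : T (((A ⊆ᵇ G) ∧ (G ⊆ᵇ C) ∧ not (G ≐ B)) ∧ ((L ⊆ᵇ G) ∧ not (L ⊆ᵇ A))) →
         T ((G ≐ (L ⊕ A)) ∧ ((L ⊆ᵇ C) ∧ not (L ⊆ᵇ B)))
    to h =
      let neighbour , through = T-∧⁻ h
          A⊆ᵇG , G⊆ᵇC∧G≉B = T-∧⁻ neighbour
          G⊆ᵇC , G≉B = T-∧⁻ G⊆ᵇC∧G≉B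
          L⊆G = ⊆ᵇ⁻ {L} {G} (proj₁ (T-∧⁻ through))
          L⊕A≗G = L⊕A-fills hG L⊆G (⊆ᵇ⁻ {A} {G} A⊆ᵇG)
      in T-∧⁺ (≐⁺ {G} {L ⊕ A} (sym ∘ L⊕A≗G))
              (T-∧⁺ (⊆ᵇ⁺ {L} {C} (⊆ᵇ⁻ {G} {C} G⊆ᵇC ∘ L⊆G))
                    (T-not⁺ λ L⊆ᵇB → T-not⁻ G≉B (≐⁺ {G} {B} λ v →
                      trans (sym (L⊕A≗G v)) (L⊕A-fills hB (⊆ᵇ⁻ {L} {B} L⊆ᵇB) A⊆B v))))

    from : T ((G ≐ (L ⊕ A)) ∧ ((L ⊆ᵇ C) ∧ not (L ⊆ᵇ B))) →
           T (((A ⊆ᵇ G) ∧ (G ⊆ᵇ C) ∧ not (G ≐ B)) ∧ ((L ⊆ᵇ G) ∧ not (L ⊆ᵇ A)))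
    from h =
      let G≐L⊕A , L⊆ᵇC∧L⊈ᵇB = T-∧⁻ h
          L⊆ᵇC , L⊈ᵇB = T-∧⁻ L⊆ᵇC∧L⊈ᵇB
          G≗L⊕A = ≐⁻ {G} {L ⊕ A} G≐L⊕A
          L⊆G : L ⊆ₛ G
          L⊆G = λ {v} Lv → subst T (sym (G≗L⊕A v)) (⊆-⊕ˡ {L} hA Lv)
          A⊆G : A ⊆ₛ G
          A⊆G = λ {v} Av → subst T (sym (G≗L⊕A v)) (⊆-⊕ʳ {L} {A} hL Av)
          G⊆C : G ⊆ₛ C
          G⊆C = λ {v} Gv → ⊕-least hC (⊆ᵇ⁻ {L} {C} L⊆ᵇC) (B⊆C ∘ A⊆B) (subst T (G≗L⊕A v) Gv)
          G≉B : ¬ T (G ≐ B)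
          G≉B = λ G≐B → T-not⁻ L⊈ᵇB (⊆ᵇ⁺ {L} {B} λ {v} Lv → subst T (≐⁻ {G} {B} G≐B v) (L⊆G Lv))
      in T-∧⁺ (T-∧⁺ (⊆ᵇ⁺ {A} {G} A⊆G) (T-∧⁺ (⊆ᵇ⁺ {G} {C} G⊆C) (T-not⁺ G≉B)))
              (T-∧⁺ (⊆ᵇ⁺ {L} {G} L⊆G) (T-not⁺ (L⊈A ∘ ⊆ᵇ⁻ {L} {A})))

  concatMap-when-≐ : ∀ {A : Set} {S} (xs : List A) Gs → Distinct Gs → (∃ λ G → G ∈ Gs × G ≗ S) →
    concatMap (λ G → xs when (G ≐ S)) Gs ≡ xs
  concatMap-when-≐ {S = S} xs (G ∷ Gs) (G≉Gs ∷ distinct) (G′ , G′∈ , G′≗S) with G ≐ S in G≐S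
  ... | true = trans (cong (xs ++_) (concatMap-≡[] _ Gs no-other)) (ListP.++-identityʳ xs)
    where
    no-other : ∀ {G′} → G′ ∈ Gs → xs when (G′ ≐ S) ≡ []
    no-other {G′} G′∈ with G′ ≐ S in G′≐S
    ... | false = refl
    ... | true  = ⊥-elim (All.lookup G≉Gs G′∈ (≐⁺ {G} {G′} λ v →
                    trans (≐⁻ {G} {S} (subst T (sym G≐S) _) v) (sym (≐⁻ {G′} {S} (subst T (sym G′≐S) _) v))))
  ... | false with G′∈
  ...   | here refl   = ⊥-elim (subst T G≐S (≐⁺ {G} {S} G′≗S))
  ...   | there G′∈Gs = concatMap-when-≐ xs Gs distinct (G′ , G′∈Gs , G′≗S)

  Gr-when-≐ : ∀ {A : Set} {S d} → HasBasis S d → (xs : List A) →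
    concatMap (λ G → xs when (G ≐ S)) (Gr d) ≡ xs
  Gr-when-≐ hS xs = concatMap-when-≐ xs _ (dedup-distinct _) (Gr-complete hS)

module Flags {q : ℕ} (K : FieldOn q) (n : ℕ) where
  open FlagTheory K n hiding (0V; _+V_; _-V_; _·V_)
  open Subspaces K n
  open Multiplicity flagEq

  infix 4 _≅_
  _≅_ : RawFlag → RawFlag → Set
  F ≅ F′ = ∀ k → lookup F k ≗ lookup F′ k

  ≐-respʳ : ∀ S {S′ S″} → S′ ≗ S″ → (S ≐ S′) ≡ (S ≐ S″)
  ≐-respʳ S {S′} {S″} S′≗S″ =
    T-extensional (λ h → ≐⁺ {S} {S″} λ v → trans (≐⁻ {S} {S′} h v) (S′≗S″ v))
                  (λ h → ≐⁺ {S} {S′} λ v → trans (≐⁻ {S} {S″} h v) (sym (S′≗S″ v)))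

  flagEq-resp : ∀ H {F F′} → F ≅ F′ → flagEq H F ≡ flagEq H F′
  flagEq-resp H F≅F′ = cong and (ListP.map-cong (λ k → ≐-respʳ (lookup H k) (F≅F′ k)) (List.allFin n))

  [-]-resp-≅ : ∀ {F F′} → F ≅ F′ → [ F ] ≋ [ F′ ]
  [-]-resp-≅ {F} {F′} F≅F′ H with flagEq H F | flagEq H F′ | flagEq-resp H {F} {F′} F≅F′
  ... | true  | true  | _ = refl
  ... | false | false | _ = refl

  pos-lookup : ∀ {m} (F : Vec Sub m) (k : Fin m) → pos F (suc (toℕ k)) ≡ lookup F k
  pos-lookup (S ∷ F) Fin.zero    = refl
  pos-lookup (S ∷ F) (Fin.suc k) = pos-lookup F k

  pos-suc : ∀ (F : RawFlag) {j} (j<n : j < n) → pos F (suc j) ≡ lookup F (fromℕ< j<n)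
  pos-suc F j<n = trans (cong (pos F ∘ suc) (sym (FinP.toℕ-fromℕ< j<n))) (pos-lookup F (fromℕ< j<n))

  pos-replaceAt : ∀ F i G {j} (j<n : j < n) →
    pos (replaceAt F i G) (suc j) ≡ (if suc j ≡ᵇ i then G else pos F (suc j))
  pos-replaceAt F i G {j} j<n = begin
    pos (replaceAt F i G) (suc j)                  ≡⟨ pos-suc (replaceAt F i G) j<n ⟩
    lookup (replaceAt F i G) k                     ≡⟨ VecP.lookup∘tabulate _ k ⟩
    (if suc (toℕ k) ≡ᵇ i then G else lookup F k)   ≡⟨ cong₂ (λ t S → if suc t ≡ᵇ i then G else S)
                                                            (FinP.toℕ-fromℕ< j<n) (sym (pos-suc F j<n)) ⟩
    (if suc j ≡ᵇ i then G else pos F (suc j))      ∎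
    where
    open ≡-Reasoning
    k = fromℕ< j<n

  pos-replaceAt-≢ : ∀ F i G {j} → j ≤ n → j ≢ i → pos (replaceAt F i G) j ≡ pos F j
  pos-replaceAt-≢ F i G {zero}  _   _   = refl
  pos-replaceAt-≢ F i G {suc j} j<n j≢i =
    trans (pos-replaceAt F i G j<n) (cong (λ b → if b then G else pos F (suc j)) (≢⇒≡ᵇ-false j≢i))

  pos-replaceAt-≡ : ∀ F i G → suc i ≤ n → pos (replaceAt F (suc i) G) (suc i) ≡ G
  pos-replaceAt-≡ F i G i<n =
    trans (pos-replaceAt F (suc i) G i<n) (cong (λ b → if b then G else pos F (suc i)) (≡ᵇ-refl i))

  record IsFlagUpTo (F : RawFlag) (j : ℕ) : Set where
    field
      bounded : j ≤ n
      dim     : ∀ {k} → k ≤ j → HasBasis (pos F k) k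
      nested  : ∀ {k} → k < j → pos F k ⊆ₛ pos F (suc k)

  HasDim⇒HasBasis : ∀ {S d} → HasDim S d → HasBasis S d
  HasDim⇒HasBasis {S} (bs , ind , span≐S) =
    bs , Equivalence.from T-≡ ind , ≐⁻ {span bs} {S} (Equivalence.from T-≡ span≐S)

  IsFlag⇒IsFlagUpTo : ∀ {F} → IsFlag F → IsFlagUpTo F n
  IsFlag⇒IsFlagUpTo {F} isFlag = record { bounded = ℕP.≤-refl ; dim = dim ; nested = nested }
    where
    dim : ∀ {k} → k ≤ n → HasBasis (pos F k) k
    dim {zero}  _   = zeroSub-basis
    dim {suc k} k<n rewrite pos-suc F k<n =
      subst (HasBasis (lookup F (fromℕ< k<n)) ∘ suc) (FinP.toℕ-fromℕ< k<n)
        (HasDim⇒HasBasis (proj₁ (isFlag (fromℕ< k<n))))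
    nested : ∀ {k} → k < n → pos F k ⊆ₛ pos F (suc k)
    nested {k} k<n rewrite pos-suc F k<n =
      subst (λ t → pos F t ⊆ₛ lookup F (fromℕ< k<n)) (FinP.toℕ-fromℕ< k<n)
        (⊆ᵇ⁻ {pos F (toℕ (fromℕ< k<n))} (Equivalence.from T-≡ (proj₂ (isFlag (fromℕ< k<n)))))

  IsFlagUpTo-≤ : ∀ {F j j′} → j ≤ j′ → IsFlagUpTo F j′ → IsFlagUpTo F j
  IsFlagUpTo-≤ j≤j′ flag = record
    { bounded = ℕP.≤-trans j≤j′ bounded
    ; dim     = λ k≤j → dim (ℕP.≤-trans k≤j j≤j′)
    ; nested  = λ k<j → nested (ℕP.<-≤-trans k<j j≤j′)
    }
    where open IsFlagUpTo flag

  -- The spaces G summed over in F · T_{s_i}, and the lines L summed over in the i-th summand of x^{(q)}(F).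
  tNeighbour : RawFlag → ℕ → Sub → Bool
  tNeighbour F i G = (pos F (i ∸ 1) ⊆ᵇ G) ∧ (G ⊆ᵇ pos F (suc i)) ∧ not (G ≐ pos F i)

  xLine : RawFlag → ℕ → Sub → Bool
  xLine F i L = (L ⊆ᵇ pos F i) ∧ not (L ⊆ᵇ pos F (i ∸ 1))

  -- The (m+1)-st summand, so that x^{(q)}(F) = Σ_{m<n} xSummand F m.
  xSummand : RawFlag → ℕ → FSum
  xSummand F m = map (newFlag F (suc m)) (filterᵇ (xLine F (suc m)) (Gr 1))

  replaceAt-IsFlagUpTo : ∀ {F m G} → IsFlagUpTo F (suc (suc m)) → HasBasis G (suc m) →
    T (tNeighbour F (suc m) G) → IsFlagUpTo (replaceAt F (suc m) G) (suc m)
  replaceAt-IsFlagUpTo {F} {m} {G} flag hG neighbour = record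
    { bounded = m<n ; dim = dim′ ; nested = nested′ }
    where
    open IsFlagUpTo flag
    m<n : suc m ≤ n
    m<n = ℕP.<⇒≤ bounded
    F′ = replaceAt F (suc m) G
    dim′ : ∀ {k} → k ≤ suc m → HasBasis (pos F′ k) k
    dim′ {k} k≤ with k ℕ.≟ suc m
    ... | yes refl = subst (λ S → HasBasis S (suc m)) (sym (pos-replaceAt-≡ F m G m<n)) hG
    ... | no  k≢   = subst (λ S → HasBasis S k) (sym (pos-replaceAt-≢ F (suc m) G (ℕP.≤-trans k≤ m<n) k≢))
                       (dim (ℕP.m≤n⇒m≤1+n k≤))
    nested′ : ∀ {k} → k < suc m → pos F′ k ⊆ₛ pos F′ (suc k)
    nested′ {k} k< rewrite pos-replaceAt-≢ F (suc m) G (ℕP.≤-trans (ℕP.<⇒≤ k<) m<n) (ℕP.<⇒≢ k<)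
      with suc k ℕ.≟ suc m
    ... | yes refl rewrite pos-replaceAt-≡ F k G m<n = ⊆ᵇ⁻ {pos F k} (proj₁ (T-∧⁻ neighbour))
    ... | no  k≢   rewrite pos-replaceAt-≢ F (suc m) G (ℕP.≤-trans k< m<n) k≢ = nested (ℕP.m<n⇒m<1+n k<)

  lookup-newFlag : ∀ F i L k → lookup (newFlag F i L) k ≡
    (if suc (toℕ k) <ᵇ i then (if suc (toℕ k) ≡ᵇ 1 then L else (L ⊕ pos F (suc (toℕ k) ∸ 1))) else lookup F k)
  lookup-newFlag F i L k = VecP.lookup∘tabulate _ k

  lookup-replaceAt : ∀ F i G k → lookup (replaceAt F i G) k ≡ (if suc (toℕ k) ≡ᵇ i then G else lookup F k)
  lookup-replaceAt F i G k = VecP.lookup∘tabulate _ k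

  newFlag-replaceAt : ∀ {F m L G} → G ≗ L ⊕ pos F m →
    newFlag (replaceAt F (suc m) G) (suc m) L ≅ newFlag F (suc (suc m)) L
  newFlag-replaceAt {F} {m} {L} {G} G≗L⊕Fm k
    rewrite lookup-newFlag (replaceAt F (suc m) G) (suc m) L k
          | lookup-replaceAt F (suc m) G k
          | lookup-newFlag F (suc (suc m)) L k
    = component (toℕ k) (FinP.toℕ<n k)
    where
    F′ = replaceAt F (suc m) G
    component : ∀ t → t < n →
      (if t <ᵇ m then (if t ≡ᵇ 0 then L else (L ⊕ pos F′ t)) else (if t ≡ᵇ m then G else lookup F k))
        ≗ (if t <ᵇ suc m then (if t ≡ᵇ 0 then L else (L ⊕ pos F t)) else lookup F k)
    component t t<n with ℕP.<-cmp t m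
    ... | tri< t<m _ _
      rewrite <⇒<ᵇ-true t<m | <⇒<ᵇ-true (ℕP.m<n⇒m<1+n t<m)
            | pos-replaceAt-≢ F (suc m) G (ℕP.<⇒≤ t<n) (ℕP.<⇒≢ (ℕP.m<n⇒m<1+n t<m)) = λ _ → refl
    ... | tri> _ _ m<t
      rewrite ≥⇒<ᵇ-false (ℕP.<⇒≤ m<t) | ≢⇒≡ᵇ-false (ℕP.>⇒≢ m<t) | ≥⇒<ᵇ-false {t} {suc m} m<t
      = λ _ → refl
    ... | tri≈ _ refl _
      rewrite ≥⇒<ᵇ-false (ℕP.≤-refl {t}) | ≡ᵇ-refl t | <⇒<ᵇ-true (ℕP.n<1+n t) = G≗ t G≗L⊕Fm
      where
      G≗ : ∀ t → G ≗ L ⊕ pos F t → G ≗ (if t ≡ᵇ 0 then L else (L ⊕ pos F t))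
      G≗ zero    G≗L⊕0 v = trans (G≗L⊕0 v) (⊕-identityʳ L v)
      G≗ (suc t) G≗L⊕Ft  = G≗L⊕Ft

  neighbour∧xLine : ∀ {F m G L} → IsFlagUpTo F (suc (suc m)) → HasBasis G (suc m) → HasBasis L 1 →
    ¬ L ⊆ₛ pos F m →
    tNeighbour F (suc m) G ∧ xLine (replaceAt F (suc m) G) (suc m) L
      ≡ (G ≐ (L ⊕ pos F m)) ∧ xLine F (suc (suc m)) L
  neighbour∧xLine {F} {m} {G} {L} flag hG hL L⊈Fm = trans
    (cong (tNeighbour F (suc m) G ∧_)
      (cong₂ (λ X Y → (L ⊆ᵇ X) ∧ not (L ⊆ᵇ Y))
        (pos-replaceAt-≡ F m G (ℕP.<⇒≤ bounded))
        (pos-replaceAt-≢ F (suc m) G (ℕP.≤-trans (ℕP.n≤1+n m) (ℕP.<⇒≤ bounded)) (ℕP.<⇒≢ (ℕP.n<1+n m)))))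
    (neighbour-through-line (dim (ℕP.≤-trans (ℕP.n≤1+n m) (ℕP.n≤1+n _))) (dim (ℕP.n≤1+n _)) (dim ℕP.≤-refl)
      (nested (ℕP.≤-trans (ℕP.n<1+n m) (ℕP.n≤1+n _))) (nested ℕP.≤-refl) hG hL L⊈Fm)
    where open IsFlagUpTo flag

  xLine-1 : ∀ {F L} → IsFlagUpTo F 1 → HasBasis L 1 → xLine F 1 L ≡ (L ≐ pos F 1)
  xLine-1 {F} {L} flag hL@(w ∷ [] , ind , span[w]≗L) = T-extensional to from
    where
    open IsFlagUpTo flag
    to : T (xLine F 1 L) → T (L ≐ pos F 1)
    to h = ≐⁺ {L} {pos F 1} (equal-dim-⊆⇒≗ hL (dim ℕP.≤-refl) (⊆ᵇ⁻ {L} {pos F 1} (proj₁ (T-∧⁻ h))))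
    from : T (L ≐ pos F 1) → T (xLine F 1 L)
    from h = T-∧⁺ (⊆ᵇ⁺ {L} {pos F 1} λ {v} → subst T (≐⁻ {L} {pos F 1} h v))
                  (T-not⁺ λ L⊆0 → line-nonzero ind (toWitness (⊆ᵇ⁻ {L} {zeroSub} L⊆0 (line-∋ span[w]≗L))))

  xSummand-zero : ∀ {F} → IsFlagUpTo F 1 → xSummand F 0 ≋ [ F ]
  xSummand-zero {F} flag = begin
    xSummand F 0                                                ≡⟨ map-filterᵇ (newFlag F 1) (xLine F 1) (Gr 1) ⟩
    concatMap (λ L → [ newFlag F 1 L ] when xLine F 1 L) (Gr 1) ≈⟨ concatMap⁺ (Gr 1) summand ⟩
    concatMap (λ L → [ F ] when (L ≐ pos F 1)) (Gr 1)           ≡⟨ Gr-when-≐ (dim ℕP.≤-refl) [ F ] ⟩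
    [ F ]                                                       ∎
    where
    open IsFlagUpTo flag
    open SetoidReasoning ≋-setoid
    summand : ∀ {L} → L ∈ Gr 1 → [ newFlag F 1 L ] when xLine F 1 L ≋ [ F ] when (L ≐ pos F 1)
    summand L∈ = ≡⇒≋ (cong₂ (λ F′ b → [ F′ ] when b) (VecP.tabulate∘lookup F) (xLine-1 flag (Gr-basis L∈)))

  -- The terms of F · T_{s_{m+1}} T_{s_m} ⋯ T_{s_1}, indexed by the space G replacing F_{m+1} and by a line L.
  stepSummand : RawFlag → ℕ → Sub → Sub → FSum
  stepSummand F m G L = [ newFlag F′ (suc m) L ] when (tNeighbour F (suc m) G ∧ xLine F′ (suc m) L)
    where F′ = replaceAt F (suc m) G

  xLine-replaceAt-⊆ : ∀ {F m G L} → suc m ≤ n → T (L ⊆ᵇ pos F m) →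
    xLine (replaceAt F (suc m) G) (suc m) L ≡ false
  xLine-replaceAt-⊆ {F} {m} {G} {L} m<n L⊆ᵇFm = ¬T⇒≡false λ new →
    T-not⁻ (proj₂ (T-∧⁻ {L ⊆ᵇ pos (replaceAt F (suc m) G) (suc m)} new))
      (subst (λ S → T (L ⊆ᵇ S)) (sym (pos-replaceAt-≢ F (suc m) G (ℕP.<⇒≤ m<n) (ℕP.<⇒≢ (ℕP.n<1+n m))))
        L⊆ᵇFm)

  neighbours-through-line : ∀ {F m L} → IsFlagUpTo F (suc (suc m)) → HasBasis L 1 →
    concatMap (λ G → stepSummand F m G L) (Gr (suc m)) ≋ [ newFlag F (suc (suc m)) L ] when xLine F (suc (suc m)) L
  neighbours-through-line {F} {m} {L} flag hL with T? (L ⊆ᵇ pos F m)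
  ... | yes L⊆ᵇFm = ≡⇒≋ (begin
    concatMap (λ G → stepSummand F m G L) (Gr (suc m))  ≡⟨ concatMap-≡[] _ (Gr (suc m)) (λ _ → no-step _) ⟩
    []                                                   ≡⟨ cong (target when_) not-new ⟨
    target when xLine F (suc (suc m)) L                  ∎)
    where
    open IsFlagUpTo flag
    open ≡-Reasoning
    target = [ newFlag F (suc (suc m)) L ]
    no-step : ∀ G → stepSummand F m G L ≡ []
    no-step G = cong ([ newFlag (replaceAt F (suc m) G) (suc m) L ] when_)
      (trans (cong (tNeighbour F (suc m) G ∧_) (xLine-replaceAt-⊆ (ℕP.<⇒≤ bounded) L⊆ᵇFm)) (∧-zeroʳ _))
    not-new : xLine F (suc (suc m)) L ≡ false
    not-new = ¬T⇒≡false λ new → T-not⁻ (proj₂ (T-∧⁻ {L ⊆ᵇ pos F (suc (suc m))} new))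
      (⊆ᵇ⁺ {L} (nested (ℕP.≤-trans (ℕP.n<1+n m) (ℕP.n≤1+n _)) ∘ ⊆ᵇ⁻ {L} L⊆ᵇFm))
  ... | no L⊈ᵇFm = begin
    concatMap (λ G → stepSummand F m G L) (Gr (suc m))
      ≈⟨ concatMap⁺ (Gr (suc m)) summand ⟩
    concatMap (λ G → target when (G ≐ (L ⊕ pos F m))) (Gr (suc m))
      ≡⟨ Gr-when-≐ (line-⊕-basis hL (dim m≤2+m) L⊈Fm) target ⟩
    target
      ∎
    where
    open IsFlagUpTo flag
    open SetoidReasoning ≋-setoid
    F′ = replaceAt F (suc m)
    m≤2+m = ℕP.≤-trans (ℕP.n≤1+n m) (ℕP.n≤1+n _)
    target = [ newFlag F (suc (suc m)) L ] when xLine F (suc (suc m)) L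
    L⊈Fm : ¬ L ⊆ₛ pos F m
    L⊈Fm = L⊈ᵇFm ∘ ⊆ᵇ⁺ {L}
    summand : ∀ {G} → G ∈ Gr (suc m) → stepSummand F m G L ≋ target when (G ≐ (L ⊕ pos F m))
    summand {G} G∈ = begin
      stepSummand F m G L
        ≡⟨ cong ([ newFlag (F′ G) (suc m) L ] when_) (neighbour∧xLine flag (Gr-basis G∈) hL L⊈Fm) ⟩
      [ newFlag (F′ G) (suc m) L ] when ((G ≐ (L ⊕ pos F m)) ∧ xLine F (suc (suc m)) L)
        ≡⟨ when-∧ _ (G ≐ (L ⊕ pos F m)) _ ⟨
      ([ newFlag (F′ G) (suc m) L ] when xLine F (suc (suc m)) L) when (G ≐ (L ⊕ pos F m))
        ≈⟨ when⁺ (G ≐ (L ⊕ pos F m)) (λ G≐ → when⁺ (xLine F (suc (suc m)) L) λ _ →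
             [-]-resp-≅ (newFlag-replaceAt (≐⁻ {G} G≐))) ⟩
      target when (G ≐ (L ⊕ pos F m))
        ∎

  applyDown-[] : ∀ m → applyDown m [] ≡ []
  applyDown-[] zero    = refl
  applyDown-[] (suc m) = applyDown-[] m

  applyDown-++ : ∀ m xs ys → applyDown m (xs ++ ys) ≡ applyDown m xs ++ applyDown m ys
  applyDown-++ zero    xs ys = refl
  applyDown-++ (suc m) xs ys =
    trans (cong (applyDown m) (ListP.concatMap-++ (actT (suc m)) xs ys)) (applyDown-++ m _ _)

  applyDown-concatMap : ∀ m xs → applyDown m xs ≡ concatMap (λ F → applyDown m [ F ]) xs
  applyDown-concatMap m []       = applyDown-[] m
  applyDown-concatMap m (F ∷ xs) =
    trans (applyDown-++ m [ F ] xs) (cong (applyDown m [ F ] ++_) (applyDown-concatMap m xs))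

  applyDown≋xSummand : ∀ m {F} → IsFlagUpTo F (suc m) → applyDown m [ F ] ≋ xSummand F m
  applyDown≋xSummand zero    flag H = sym (xSummand-zero flag H)
  applyDown≋xSummand (suc m) {F} flag = begin
    applyDown (suc m) [ F ]
      ≡⟨ trans (cong (applyDown m) (ListP.++-identityʳ _)) (applyDown-concatMap m _) ⟩
    concatMap (λ F″ → applyDown m [ F″ ]) (map F′ neighbours)
      ≡⟨ trans (ListP.concatMap-map (λ F″ → applyDown m [ F″ ]) F′ neighbours)
               (concatMap-filterᵇ (λ G → applyDown m [ F′ G ]) (tNeighbour F (suc m)) (Gr (suc m))) ⟩
    concatMap (λ G → applyDown m [ F′ G ] when tNeighbour F (suc m) G) (Gr (suc m))
      ≈⟨ concatMap⁺ (Gr (suc m)) (λ {G} G∈ → when⁺ (tNeighbour F (suc m) G) λ neighbour →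
           applyDown≋xSummand m (replaceAt-IsFlagUpTo flag (Gr-basis G∈) neighbour)) ⟩
    concatMap (λ G → xSummand (F′ G) m when tNeighbour F (suc m) G) (Gr (suc m))
      ≡⟨ ListP.concatMap-cong (λ G → map-filterᵇ-when _ (xLine (F′ G) (suc m)) (Gr 1) (tNeighbour F (suc m) G))
                              (Gr (suc m)) ⟩
    concatMap (λ G → concatMap (stepSummand F m G) (Gr 1)) (Gr (suc m))
      ≈⟨ concatMap-comm (stepSummand F m) (Gr (suc m)) (Gr 1) ⟩
    concatMap (λ L → concatMap (λ G → stepSummand F m G L) (Gr (suc m))) (Gr 1)
      ≈⟨ concatMap⁺ (Gr 1) (λ L∈ → neighbours-through-line flag (Gr-basis L∈)) ⟩
    concatMap (λ L → [ newFlag F (suc (suc m)) L ] when xLine F (suc (suc m)) L) (Gr 1)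
      ≡⟨ map-filterᵇ (newFlag F (suc (suc m))) (xLine F (suc (suc m))) (Gr 1) ⟨
    xSummand F (suc m)
      ∎
    where
    open SetoidReasoning ≋-setoid
    F′ = replaceAt F (suc m)
    neighbours = filterᵇ (tNeighbour F (suc m)) (Gr (suc m))

proposition4p10 : (q : ℕ) → IsPrimePower q → (K : FieldOn q) → (n : ℕ) →
    (F : FlagTheory.RawFlag K n) → FlagTheory.IsFlag K n F →
    FlagTheory._≈_ K n (FlagTheory.xq K n F) (FlagTheory.FTstar K n F)
proposition4p10 q _ K n F isFlag = concatMap⁺ (upTo n) λ {m} m∈ H →
  sym (applyDown≋xSummand m (IsFlagUpTo-≤ (∈P.∈-upTo⁻ m∈) (IsFlag⇒IsFlagUpTo isFlag)) H)
  where
  open Flags K n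
  open Multiplicity (FlagTheory.flagEq K n)
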